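{- For every $n \in \mathbb{N}$ and every integer $j$ with $\max(1,\lfloor n/2 \rfloor) \le j \le n$, $d_w(P_n, j) = \binom{j+1}{n-j}$.
   Context: All graphs are finite and simple. For a connected graph $H$, a non-empty set $S \subseteq V(H)$ is a weakly connected dominating set of $H$ if the spanning subgraph of $H$ obtained by removing all edges joining two vertices of $V(H)\setminus S$ is connected. $d_w(H,j)$ is the number of weakly connected dominating sets of $H$ of cardinality $j$. $P_n$ is the path on $n$ vertices. Binomial coefficients $\binom{a}{b}$ with $b>a$ are $0$. -}

module Defs where

open import Data.Nat using (ℕ; suc; _≤_; _∸_; ⌊_/2⌋)
open import Data.Nat.Combinatorics using (_C_)
open import Data.Fin using (Fin; toℕ)
open import Data.Fin.Subset using (Subset; _∈_; Nonempty; ∣_∣)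
open import Data.Product using (_×_; Σ)
open import Data.Sum using (_⊎_)
open import Data.List using (List; length)
open import Data.List.Relation.Unary.Unique.Propositional using (Unique)
import Data.List.Membership.Propositional as M
open import Relation.Binary.PropositionalEquality using (_≡_)
open import Relation.Binary.Construct.Closure.ReflexiveTransitive using (Star)
open import Function.Bundles using (_⇔_)

PathAdj : ∀ {n} → Fin n → Fin n → Set
PathAdj u v = suc (toℕ u) ≡ toℕ v ⊎ suc (toℕ v) ≡ toℕ u

WEdge : ∀ {n} → Subset n → Fin n → Fin n → Set
WEdge S u v = PathAdj u v × (u ∈ S ⊎ v ∈ S)

WConnected : ∀ {n} → Subset n → Set
WConnected {n} S = (u v : Fin n) → Star (WEdge S) u v

IsWCDS : ∀ {n} → Subset n → Set
IsWCDS S = Nonempty S × WConnected S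

HasCount : (n j k : ℕ) → Set
HasCount n j k =
  Σ (List (Subset n)) λ L →
    Unique L × length L ≡ k ×
    ((S : Subset n) → (S M.∈ L) ⇔ (∣ S ∣ ≡ j × IsWCDS S))

-- For the path, keeping only the edges with an endpoint in S leaves a
-- connected spanning subgraph exactly when every edge {i, i+1} of P_n has
-- an endpoint in S, i.e. when S is a vertex cover of P_n: a deleted edge
-- {u, u+1} separates {0,…,u} from the rest, and conversely if no edge is
-- deleted the whole path survives.  On characteristic vectors the cover
-- condition says that no two consecutive entries are both outside S.
--
-- Such vectors of length n+2 with j+1 entries inside start either with
-- `inside` followed by a cover of length n+1 with j entries inside, or with
-- `outside inside` followed by a cover of length n with j entries inside.
-- This gives an explicit duplicate-free enumeration `covers n j` whose length
-- satisfies the Pascal-type recursion c(n+2, j+1) = c(n+1, j) + c(n, j),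
-- whence c(n, j) = C(j+1, n-j) for j ≤ n.  A cover of positive size is
-- nonempty, so for 1 ≤ j ≤ n the list enumerates precisely the weakly
-- connected dominating sets of size j, which proves the theorem.
module Submission where

open import Defs
open import Data.Nat using (ℕ; _≤_; _∸_; _+_; _⊔_; ⌊_/2⌋)
open import Data.Nat.Combinatorics using (_C_)

open import Data.Nat using (zero; suc; _<_; z≤n; s≤s)
open import Data.Nat.Properties
  using ( ≤-refl; ≤-trans; n≤1+n; 1+n≰n; m≤n⇒m<n∨m≡n; m≤n⇒m≤1+n; n<1+n; <-trans
        ; ≤-<-trans; m≤m+n; m≤m⊔n; ≤-total; +-suc; +-identityʳ; +-comm
        ; m+[n∸m]≡n; +-∸-assoc; n∸n≡0; suc-injective; >⇒≢ )
open import Data.Nat.Combinatorics using (k>n⇒nCk≡0; nCk+nC[k+1]≡[n+1]C[k+1])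
open import Data.Vec using ([]; _∷_; here; there)
open import Data.Fin using (Fin; toℕ; fromℕ<) renaming (zero to fzero; suc to fsuc)
open import Data.Fin.Properties using (toℕ-injective; toℕ-fromℕ<; toℕ<n)
open import Data.Fin.Subset using (Subset; _∈_; _∉_; Nonempty; ∣_∣; inside; outside)
open import Data.Fin.Subset.Properties using (_∈?_; nonempty?; Empty-unique; ∣⊥∣≡0)
open import Data.Product using (_×_; _,_; proj₂)
open import Data.Sum using (_⊎_; inj₁; inj₂; [_,_]; swap)
open import Data.Unit using (⊤; tt)
open import Data.Empty using (⊥)
open import Data.List using (List; []; _∷_; _++_; map; length)
open import Data.List.Properties using (length-++; length-map)
open import Data.List.Relation.Unary.Unique.Propositional using (Unique)
import Data.List.Relation.Unary.Unique.Propositional.Properties as Unique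
open import Data.List.Relation.Unary.AllPairs using ([]; _∷_)
open import Data.List.Relation.Unary.All using ([])
open import Data.List.Relation.Unary.Any using (here)
import Data.List.Membership.Propositional as List
open import Data.List.Membership.Propositional.Properties
  using (∈-map⁺; ∈-map⁻; ∈-++⁺ˡ; ∈-++⁺ʳ; ∈-++⁻)
open import Relation.Nullary using (¬_; yes; no; contradiction)
open import Relation.Binary.PropositionalEquality
  using (_≡_; refl; sym; trans; cong; cong₂; subst; module ≡-Reasoning)
open import Relation.Binary.Construct.Closure.ReflexiveTransitive using (Star; ε; _◅_; reverse)
open import Function.Base using (_∘_)
open import Function.Bundles using (mk⇔)

VertexCover : ∀ {n} → Subset n → Set
VertexCover {n} S = (u v : Fin n) → suc (toℕ u) ≡ toℕ v → u ∈ S ⊎ v ∈ S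

-- If both ends of the edge {u, u+1} lie outside S, that edge is deleted and
-- the initial segment {0,…,u} is closed under the surviving edges; hence no
-- walk crosses from u to u+1.
module DeletedEdge {n} {S : Subset n} {u v : Fin n}
                   (u+1≡v : suc (toℕ u) ≡ toℕ v) (u∉S : u ∉ S) (v∉S : v ∉ S) where

  edge-stays-left : ∀ {a b} → WEdge S a b → toℕ a ≤ toℕ u → toℕ b ≤ toℕ u
  edge-stays-left (inj₂ b+1≡a , _) a≤u =
    ≤-trans (n≤1+n _) (subst (_≤ toℕ u) (sym b+1≡a) a≤u)
  edge-stays-left {a} {b} (inj₁ a+1≡b , a∈S⊎b∈S) a≤u with m≤n⇒m<n∨m≡n a≤u
  ... | inj₁ a<u = subst (_≤ toℕ u) a+1≡b a<u
  ... | inj₂ ⟨a⟩≡⟨u⟩ = contradiction a∈S⊎b∈S [ u∉S ∘ subst (_∈ S) a≡u , v∉S ∘ subst (_∈ S) b≡v ]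
    where
    a≡u : a ≡ u
    a≡u = toℕ-injective ⟨a⟩≡⟨u⟩
    b≡v : b ≡ v
    b≡v = toℕ-injective (trans (sym a+1≡b) (trans (cong suc ⟨a⟩≡⟨u⟩) u+1≡v))

  walk-stays-left : ∀ {a b} → Star (WEdge S) a b → toℕ a ≤ toℕ u → toℕ b ≤ toℕ u
  walk-stays-left ε        a≤u = a≤u
  walk-stays-left (e ◅ es) a≤u = walk-stays-left es (edge-stays-left e a≤u)

  no-walk-across : ¬ Star (WEdge S) u v
  no-walk-across w = 1+n≰n (subst (_≤ toℕ u) (sym u+1≡v) (walk-stays-left w ≤-refl))

connected⇒cover : ∀ {n} {S : Subset n} → WConnected S → VertexCover S
connected⇒cover {S = S} conn u v u+1≡v with u ∈? S | v ∈? S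
... | yes u∈S | _       = inj₁ u∈S
... | no  _   | yes v∈S = inj₂ v∈S
... | no  u∉S | no  v∉S = contradiction (conn u v) (DeletedEdge.no-walk-across u+1≡v u∉S v∉S)

walk-right : ∀ {n} {S : Subset n} → VertexCover S →
             (k : ℕ) (a b : Fin n) → toℕ a + k ≡ toℕ b → Star (WEdge S) a b
walk-right {S = S} cover zero a b a+0≡b =
  subst (Star (WEdge S) a) (toℕ-injective (trans (sym (+-identityʳ _)) a+0≡b)) ε
walk-right {n} {S} cover (suc k) a b a+k+1≡b =
  (inj₁ (sym next-a) , cover a a′ (sym next-a)) ◅ walk-right cover k a′ b a′+k≡b
  where
  a+1+k≡b : suc (toℕ a) + k ≡ toℕ b
  a+1+k≡b = trans (sym (+-suc (toℕ a) k)) a+k+1≡b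
  a+1<n : suc (toℕ a) < n
  a+1<n = ≤-<-trans (m≤m+n _ k) (subst (_< n) (sym a+1+k≡b) (toℕ<n b))
  a′ : Fin n
  a′ = fromℕ< a+1<n
  next-a : toℕ a′ ≡ suc (toℕ a)
  next-a = toℕ-fromℕ< a+1<n
  a′+k≡b : toℕ a′ + k ≡ toℕ b
  a′+k≡b = trans (cong (_+ k) next-a) a+1+k≡b

wedge-sym : ∀ {n} {S : Subset n} {a b} → WEdge S a b → WEdge S b a
wedge-sym (adj , ends) = swap adj , swap ends

cover⇒connected : ∀ {n} {S : Subset n} → VertexCover S → WConnected S
cover⇒connected cover u v with ≤-total (toℕ u) (toℕ v)
... | inj₁ u≤v = walk-right cover (toℕ v ∸ toℕ u) u v (m+[n∸m]≡n u≤v)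
... | inj₂ v≤u = reverse wedge-sym (walk-right cover (toℕ u ∸ toℕ v) v u (m+[n∸m]≡n v≤u))

NoTwoOutside : ∀ {n} → Subset n → Set
NoTwoOutside []          = ⊤
NoTwoOutside (_ ∷ [])    = ⊤
NoTwoOutside (x ∷ y ∷ p) = (x ≡ inside ⊎ y ≡ inside) × NoTwoOutside (y ∷ p)

cover⇒NoTwoOutside : ∀ {n} (S : Subset n) → VertexCover S → NoTwoOutside S
cover⇒NoTwoOutside []          cover = tt
cover⇒NoTwoOutside (_ ∷ [])    cover = tt
cover⇒NoTwoOutside (x ∷ y ∷ p) cover =
  first-edge (cover fzero (fsuc fzero) refl) , cover⇒NoTwoOutside (y ∷ p) tail-cover
  where
  first-edge : fzero ∈ x ∷ y ∷ p ⊎ fsuc fzero ∈ x ∷ y ∷ p → x ≡ inside ⊎ y ≡ inside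
  first-edge (inj₁ here)         = inj₁ refl
  first-edge (inj₂ (there here)) = inj₂ refl
  tail-cover : VertexCover (y ∷ p)
  tail-cover u v u+1≡v with cover (fsuc u) (fsuc v) (cong suc u+1≡v)
  ... | inj₁ (there u∈) = inj₁ u∈
  ... | inj₂ (there v∈) = inj₂ v∈

NoTwoOutside⇒cover : ∀ {n} (S : Subset n) → NoTwoOutside S → VertexCover S
NoTwoOutside⇒cover (x ∷ y ∷ p) (inj₁ refl , _) fzero (fsuc fzero) refl = inj₁ here
NoTwoOutside⇒cover (x ∷ y ∷ p) (inj₂ refl , _) fzero (fsuc fzero) refl = inj₂ (there here)
NoTwoOutside⇒cover (x ∷ y ∷ p) (_ , rest) (fsuc u) (fsuc v) u+1≡v
  with NoTwoOutside⇒cover (y ∷ p) rest u v (suc-injective u+1≡v)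
... | inj₁ u∈ = inj₁ (there u∈)
... | inj₂ v∈ = inj₂ (there v∈)

NoTwoOutside-inside∷ : ∀ {n} (p : Subset n) → NoTwoOutside p → NoTwoOutside (inside ∷ p)
NoTwoOutside-inside∷ []      _  = tt
NoTwoOutside-inside∷ (_ ∷ p) ok = inj₁ refl , ok

NoTwoOutside-tail : ∀ {n} x (p : Subset n) → NoTwoOutside (x ∷ p) → NoTwoOutside p
NoTwoOutside-tail _ []      _  = tt
NoTwoOutside-tail _ (_ ∷ p) ok = proj₂ ok

covers : (n j : ℕ) → List (Subset n)
covers zero          zero          = [] ∷ []
covers zero          (suc j)       = []
covers (suc zero)    zero          = (outside ∷ []) ∷ []
covers (suc zero)    (suc zero)    = (inside ∷ []) ∷ []
covers (suc zero)    (suc (suc j)) = []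
covers (suc (suc n)) zero          = []
covers (suc (suc n)) (suc j)       =
  map (inside ∷_) (covers (suc n) j) ++ map (λ p → outside ∷ inside ∷ p) (covers n j)

covers-sound : ∀ n j (S : Subset n) → S List.∈ covers n j → ∣ S ∣ ≡ j × NoTwoOutside S
covers-sound zero          zero       _ (here refl) = refl , tt
covers-sound (suc zero)    zero       _ (here refl) = refl , tt
covers-sound (suc zero)    (suc zero) _ (here refl) = refl , tt
covers-sound (suc (suc n)) (suc j)    S S∈ with ∈-++⁻ (map (inside ∷_) (covers (suc n) j)) S∈
... | inj₁ S∈₁ with ∈-map⁻ (inside ∷_) S∈₁
...   | p , p∈ , refl with covers-sound (suc n) j p p∈
...     | ∣p∣≡j , ok = cong suc ∣p∣≡j , NoTwoOutside-inside∷ p ok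
covers-sound (suc (suc n)) (suc j)    S S∈ | inj₂ S∈₂ with ∈-map⁻ (λ p → outside ∷ inside ∷ p) S∈₂
...   | p , p∈ , refl with covers-sound n j p p∈
...     | ∣p∣≡j , ok = cong suc ∣p∣≡j , inj₂ refl , NoTwoOutside-inside∷ p ok

covers-complete : ∀ n j (S : Subset n) → ∣ S ∣ ≡ j → NoTwoOutside S → S List.∈ covers n j
covers-complete zero          zero          []                 _ _ = here refl
covers-complete (suc zero)    zero          (outside ∷ [])     _ _ = here refl
covers-complete (suc zero)    (suc zero)    (inside ∷ [])      _ _ = here refl
covers-complete (suc zero)    (suc (suc j)) (inside ∷ [])      () _
covers-complete (suc (suc n)) zero          (inside ∷ _ ∷ _)   () _
covers-complete (suc (suc n)) zero          (outside ∷ inside ∷ _) () _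
covers-complete (suc (suc n)) j             (outside ∷ outside ∷ _) _ (inj₁ () , _)
covers-complete (suc (suc n)) j             (outside ∷ outside ∷ _) _ (inj₂ () , _)
covers-complete (suc (suc n)) (suc j)       (inside ∷ y ∷ p)   ∣S∣≡ (_ , ok) =
  ∈-++⁺ˡ (∈-map⁺ (inside ∷_) (covers-complete (suc n) j (y ∷ p) (suc-injective ∣S∣≡) ok))
covers-complete (suc (suc n)) (suc j)       (outside ∷ inside ∷ p) ∣S∣≡ (_ , ok) =
  ∈-++⁺ʳ (map (inside ∷_) (covers (suc n) j))
    (∈-map⁺ (λ q → outside ∷ inside ∷ q)
      (covers-complete n j p (suc-injective ∣S∣≡) (NoTwoOutside-tail inside p ok)))

∷-injectiveʳ : ∀ {n} {a b} {p q : Subset n} → a ∷ p ≡ b ∷ q → p ≡ q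
∷-injectiveʳ refl = refl

covers-unique : ∀ n j → Unique (covers n j)
covers-unique zero          zero          = [] ∷ []
covers-unique zero          (suc j)       = []
covers-unique (suc zero)    zero          = [] ∷ []
covers-unique (suc zero)    (suc zero)    = [] ∷ []
covers-unique (suc zero)    (suc (suc j)) = []
covers-unique (suc (suc n)) zero          = []
covers-unique (suc (suc n)) (suc j)       =
  Unique.++⁺ (Unique.map⁺ ∷-injectiveʳ (covers-unique (suc n) j))
             (Unique.map⁺ (λ eq → ∷-injectiveʳ (∷-injectiveʳ eq)) (covers-unique n j))
             disjoint
  where
  disjoint : ∀ {S} → S List.∈ map (inside ∷_) (covers (suc n) j) ×
                     S List.∈ map (λ p → outside ∷ inside ∷ p) (covers n j) → ⊥
  disjoint (S∈₁ , S∈₂) with ∈-map⁻ (inside ∷_) S∈₁ | ∈-map⁻ (λ p → outside ∷ inside ∷ p) S∈₂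
  ... | _ , _ , refl | _ , _ , ()

coverCount : ℕ → ℕ → ℕ
coverCount n j = length (covers n j)

coverCount-pascal : ∀ n j → coverCount (suc (suc n)) (suc j) ≡ coverCount (suc n) j + coverCount n j
coverCount-pascal n j =
  trans (length-++ (map (inside ∷_) (covers (suc n) j)))
        (cong₂ _+_ (length-map (inside ∷_) (covers (suc n) j))
                   (length-map (λ p → outside ∷ inside ∷ p) (covers n j)))

coverCount-too-large : ∀ n j → n < j → coverCount n j ≡ 0
coverCount-too-large zero          (suc j)       _         = refl
coverCount-too-large (suc zero)    (suc zero)    (s≤s ())
coverCount-too-large (suc zero)    (suc (suc j)) _         = refl
coverCount-too-large (suc (suc n)) (suc j)       (s≤s n<j) =
  trans (coverCount-pascal n j)
        (cong₂ _+_ (coverCount-too-large (suc n) j n<j)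
                   (coverCount-too-large n j (<-trans (n<1+n n) n<j)))

coverCount-formula : ∀ n j → j ≤ n → coverCount n j ≡ suc j C (n ∸ j)
coverCount-formula zero          zero          _         = refl
coverCount-formula (suc zero)    zero          _         = refl
coverCount-formula (suc zero)    (suc zero)    _         = refl
coverCount-formula (suc zero)    (suc (suc j)) (s≤s ())
coverCount-formula (suc (suc n)) zero          _         = sym (k>n⇒nCk≡0 {1} {suc (suc n)} (s≤s (s≤s z≤n)))
coverCount-formula (suc (suc n)) (suc j)       (s≤s j≤n+1) with m≤n⇒m<n∨m≡n j≤n+1
... | inj₂ refl = begin
  coverCount (suc (suc n)) (suc (suc n))
    ≡⟨ coverCount-pascal n (suc n) ⟩
  coverCount (suc n) (suc n) + coverCount n (suc n)
    ≡⟨ cong₂ _+_ (coverCount-formula (suc n) (suc n) ≤-refl) (coverCount-too-large n (suc n) (n<1+n n)) ⟩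
  suc (suc n) C (n ∸ n) + 0
    ≡⟨ cong (λ k → suc (suc n) C k + 0) (n∸n≡0 n) ⟩
  1
    ≡⟨ cong (suc (suc (suc n)) C_) (n∸n≡0 n) ⟨
  suc (suc (suc n)) C (n ∸ n) ∎
  where open ≡-Reasoning
... | inj₁ (s≤s j≤n) = begin
  coverCount (suc (suc n)) (suc j)
    ≡⟨ coverCount-pascal n j ⟩
  coverCount (suc n) j + coverCount n j
    ≡⟨ cong₂ _+_ (coverCount-formula (suc n) j (m≤n⇒m≤1+n j≤n)) (coverCount-formula n j j≤n) ⟩
  suc j C (suc n ∸ j) + suc j C (n ∸ j)
    ≡⟨ cong (λ k → suc j C k + suc j C (n ∸ j)) (+-∸-assoc 1 j≤n) ⟩
  suc j C suc (n ∸ j) + suc j C (n ∸ j)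
    ≡⟨ +-comm (suc j C suc (n ∸ j)) _ ⟩
  suc j C (n ∸ j) + suc j C suc (n ∸ j)
    ≡⟨ nCk+nC[k+1]≡[n+1]C[k+1] (suc j) (n ∸ j) ⟩
  suc (suc j) C suc (n ∸ j)
    ≡⟨ cong (suc (suc j) C_) (+-∸-assoc 1 j≤n) ⟨
  suc (suc j) C (suc n ∸ j) ∎
  where open ≡-Reasoning

nonempty-of-positive-size : ∀ {n} (S : Subset n) → 0 < ∣ S ∣ → Nonempty S
nonempty-of-positive-size {n} S 0<∣S∣ with nonempty? S
... | yes S-nonempty = S-nonempty
... | no  S-empty   =
  contradiction (trans (cong ∣_∣ (Empty-unique S-empty)) (∣⊥∣≡0 n)) (>⇒≢ 0<∣S∣)

-- d_w(P_n, j) = C(j+1, n-j).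
theorem3p8 : (n j : ℕ) → 1 ⊔ ⌊ n /2⌋ ≤ j → j ≤ n →
    HasCount n j ((j + 1) C (n ∸ j))
theorem3p8 n j lower j≤n =
  covers n j , covers-unique n j , count , λ S → mk⇔ (listed⇒wcds S) (wcds⇒listed S)
  where
  count : length (covers n j) ≡ (j + 1) C (n ∸ j)
  count = trans (coverCount-formula n j j≤n) (cong (_C (n ∸ j)) (+-comm 1 j))
  j-positive : 1 ≤ j
  j-positive = ≤-trans (m≤m⊔n 1 ⌊ n /2⌋) lower
  listed⇒wcds : (S : Subset n) → S List.∈ covers n j → ∣ S ∣ ≡ j × IsWCDS S
  listed⇒wcds S S∈ with covers-sound n j S S∈
  ... | ∣S∣≡j , ok = ∣S∣≡j , nonempty-of-positive-size S (subst (0 <_) (sym ∣S∣≡j) j-positive) ,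
    cover⇒connected (NoTwoOutside⇒cover S ok)
  wcds⇒listed : (S : Subset n) → ∣ S ∣ ≡ j × IsWCDS S → S List.∈ covers n j
  wcds⇒listed S (∣S∣≡j , _ , conn) = covers-complete n j S ∣S∣≡j (cover⇒NoTwoOutside S (connected⇒cover conn))
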